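{- Let $G$ be a graph and let $V_1\cup V_2\cup\cdots\cup V_k$ be a partition of $V(G)$ into independent sets such that $\phi(V_j,V_i)=\emptyset$ whenever $j>i$. If $k$ is even, let $$H=\left(V_1V_2\cup V_3V_4\cup\cdots\cup V_{k-1}V_k\right)\cup\left(\phi(V_1,V_2)\phi(V_1,V_2)\cup\cdots\cup\phi(V_{k-1},V_k)\phi(V_{k-1},V_k)\right).$$ If $k$ is odd, let $$H=\left(V_1V_2\cup V_3V_4\cup\cdots\cup V_{k-2}V_{k-1}\right)\cup V_kV_k\cup\left(\phi(V_1,V_2)\phi(V_1,V_2)\cup\cdots\cup\phi(V_{k-2},V_{k-1})\phi(V_{k-2},V_{k-1})\right).$$ Then $H$ is a maximal independent set of $T_2(G)$.
   Context: All graphs are finite and simple. The $2$-token graph $T_2(G)$ has as vertices the $2$-subsets of $V(G)$, two of them adjacent if their symmetric difference is an edge of $G$. For subsets $A,B\subseteq V(G)$ (not necessarily distinct), $AB=\{\{a,b\} : a\in A,\ b\in B,\ a\neq b\}$, a set of vertices of $T_2(G)$; in particular $AA$ is the set of 2-subsets of $A$. For disjoint independent sets $A,B$ of $G$, $\phi(A,B)=\{x\in A : B\cup\{x\} \text{ is an independent set of } G\}$. A maximal independent set is an independent set not properly contained in another independent set. -}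

module Defs where

open import Data.Nat using (ℕ; zero; suc; _+_; _*_) renaming (_<_ to _<ℕ_)
open import Data.Fin using (Fin; toℕ; _<_)
open import Data.Product using (Σ; ∃; _×_; _,_; proj₁; proj₂)
open import Data.Sum using (_⊎_)
open import Data.Empty using (⊥)
open import Relation.Nullary using (¬_)
open import Relation.Binary.PropositionalEquality using (_≡_; _≢_)

record Graph (n : ℕ) : Set₁ where
  field
    Adj   : Fin n → Fin n → Set
    sym   : ∀ {u v} → Adj u v → Adj v u
    irrefl : ∀ {u} → ¬ Adj u u
open Graph public

VSet : Set → Set₁
VSet X = X → Set

_⊆_ : {X : Set} → VSet X → VSet X → Set
A ⊆ B = ∀ x → A x → B x

Independent : {n : ℕ} → Graph n → VSet (Fin n) → Set
Independent G S = ∀ u v → S u → S v → ¬ Adj G u v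

-- Vertices of the 2-token graph: 2-subsets {a,b} of Fin n, written canonically with a < b.
T2V : ℕ → Set
T2V n = Σ (Fin n × Fin n) (λ p → proj₁ p < proj₂ p)

fst snd : {n : ℕ} → T2V n → Fin n
fst p = proj₁ (proj₁ p)
snd p = proj₂ (proj₁ p)

_∈₂_ : {n : ℕ} → Fin n → T2V n → Set
z ∈₂ p = (z ≡ fst p) ⊎ (z ≡ snd p)

-- adjacency in T_2(G): the symmetric difference of p and q is an edge {x,y} of G
T2Adj : {n : ℕ} → Graph n → T2V n → T2V n → Set
T2Adj G p q = Σ _ λ x → Σ _ λ y → Adj G x y ×
  (∀ z → (((z ∈₂ p) × ¬ (z ∈₂ q)) ⊎ ((z ∈₂ q) × ¬ (z ∈₂ p))) → (z ≡ x ⊎ z ≡ y)) ×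
  (∀ z → (z ≡ x ⊎ z ≡ y) → (((z ∈₂ p) × ¬ (z ∈₂ q)) ⊎ ((z ∈₂ q) × ¬ (z ∈₂ p))))

T2Independent : {n : ℕ} → Graph n → VSet (T2V n) → Set
T2Independent G S = ∀ p q → S p → S q → ¬ T2Adj G p q

MaximalT2Independent : {n : ℕ} → Graph n → VSet (T2V n) → Set₁
MaximalT2Independent G H =
  T2Independent G H × (∀ S → T2Independent G S → H ⊆ S → S ⊆ H)

-- AB = {{a,b} : a ∈ A, b ∈ B, a ≠ b}
_··_ : {n : ℕ} → VSet (Fin n) → VSet (Fin n) → VSet (T2V n)
(A ·· B) p = (A (fst p) × B (snd p)) ⊎ (A (snd p) × B (fst p))

φ : {n : ℕ} → Graph n → VSet (Fin n) → VSet (Fin n) → VSet (Fin n)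
φ G A B x = A x × Independent G (λ z → B z ⊎ z ≡ x)

-- Partition of V(G) into k (nonempty) parts, encoded by the part-index map c;
-- Part c i is V_{i+1} in the paper's 1-based numbering (i is 0-based).
Part : {n k : ℕ} → (Fin n → Fin k) → ℕ → VSet (Fin n)
Part c i v = toℕ (c v) ≡ i

Surjective : {n k : ℕ} → (Fin n → Fin k) → Set
Surjective {n} {k} c = ∀ (i : Fin k) → Σ (Fin n) λ v → c v ≡ i

-- The set H of the theorem (0-based: pairs (V_{2m}, V_{2m+1}) with 2m+1 < k,
-- plus V_{k-1}V_{k-1} when k = 2m+1 is odd, i.e. the paper's V_k V_k).
Hset : {n k : ℕ} → Graph n → (Fin n → Fin k) → VSet (T2V n)
Hset {n} {k} G c p =
  (Σ ℕ λ m → (suc (2 * m) <ℕ k) ×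
     ((Part c (2 * m) ·· Part c (suc (2 * m))) p
      ⊎ (φ G (Part c (2 * m)) (Part c (suc (2 * m)))
         ·· φ G (Part c (2 * m)) (Part c (suc (2 * m)))) p))
  ⊎ (Σ ℕ λ m → (k ≡ suc (2 * m)) × (Part c (2 * m) ·· Part c (2 * m)) p)

-- Two 2-sets are adjacent in T₂(G) exactly when they are {x, z} and {y, z} with x ~ y in G.
-- H is therefore independent because two H-partners of a common vertex z always lie in one
-- part of the partition, except for a vertex of V₂ₘ₊₁ and a vertex of φ(V₂ₘ, V₂ₘ₊₁), which
-- are nonadjacent by the definition of φ. For maximality let {x, y} lie in an independent
-- S ⊇ H with x in a part no later than y's. Then y is nonadjacent to every H-partner w ≠ x
-- of x, so y lies in φ(V_j, V_i) for an earlier part V_i, which is excluded, unless {x, y}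
-- is itself one of the pairs of H.
module Submission where

open import Defs
open import Data.Nat using (ℕ; suc; _*_; _≤_) renaming (_<_ to _<ℕ_)
open import Data.Nat.Properties
  using (even≢odd; suc-injective; <-irrefl; <-cmp; <-trans; _<?_; ≤-antisym; ≤-pred; ≮⇒≥; ≤-total; *-suc)
open import Data.Fin using (Fin; toℕ)
open import Data.Fin.Properties using (toℕ<n) renaming (<-irrefl to <ᶠ-irrefl; <-cmp to <ᶠ-cmp; _≟_ to _≟ᶠ_)
open import Data.Product using (Σ; ∃-syntax; _×_; _,_; proj₁; proj₂)
open import Data.Sum using (_⊎_; inj₁; inj₂; [_,_]′; swap)
open import Data.Empty using (⊥-elim)
open import Function using (id; _∘_)
open import Relation.Nullary using (¬_; Dec; yes; no)
open import Relation.Nullary.Decidable using (_⊎-dec_)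
open import Relation.Binary.Definitions using (tri<; tri≈; tri>)
open import Relation.Binary.PropositionalEquality using (_≡_; _≢_; refl; trans; cong; subst) renaming (sym to ≡-sym)

private
  variable
    n : ℕ
    p q : T2V n
    x y z w : Fin n
    A : VSet (Fin n)

data _≐⟨_,_⟩ (p : T2V n) (x y : Fin n) : Set where
  straight : fst p ≡ x → snd p ≡ y → p ≐⟨ x , y ⟩
  crossed  : fst p ≡ y → snd p ≡ x → p ≐⟨ x , y ⟩

≐-canonical : p ≐⟨ fst p , snd p ⟩
≐-canonical = straight refl refl

≐-sym : p ≐⟨ x , y ⟩ → p ≐⟨ y , x ⟩
≐-sym (straight e₁ e₂) = crossed e₁ e₂
≐-sym (crossed e₁ e₂)  = straight e₁ e₂

≐⇒≢ : p ≐⟨ x , y ⟩ → x ≢ y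
≐⇒≢ {p = p} (straight refl refl) e = <ᶠ-irrefl e (proj₂ p)
≐⇒≢ {p = p} (crossed refl refl) e  = <ᶠ-irrefl (≡-sym e) (proj₂ p)

∈₂-≐ : p ≐⟨ x , y ⟩ → z ∈₂ p → z ≡ x ⊎ z ≡ y
∈₂-≐ (straight refl refl) = id
∈₂-≐ (crossed refl refl)  = swap

≐-∈₂ : p ≐⟨ x , y ⟩ → z ≡ x ⊎ z ≡ y → z ∈₂ p
≐-∈₂ (straight refl refl) = id
≐-∈₂ (crossed refl refl)  = swap

≐⇒∈₂ˡ : p ≐⟨ x , y ⟩ → x ∈₂ p
≐⇒∈₂ˡ p≐ = ≐-∈₂ p≐ (inj₁ refl)

≐⇒∈₂ʳ : p ≐⟨ x , y ⟩ → y ∈₂ p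
≐⇒∈₂ʳ p≐ = ≐-∈₂ p≐ (inj₂ refl)

∈₂⇒≐ : x ∈₂ p → ∃[ z ] p ≐⟨ x , z ⟩
∈₂⇒≐ (inj₁ refl) = _ , straight refl refl
∈₂⇒≐ (inj₂ refl) = _ , crossed refl refl

∈₂-∈₂⇒≐ : x ∈₂ p → y ∈₂ p → x ≢ y → p ≐⟨ x , y ⟩
∈₂-∈₂⇒≐ (inj₁ refl) (inj₁ refl) x≢y = ⊥-elim (x≢y refl)
∈₂-∈₂⇒≐ (inj₁ refl) (inj₂ refl) _   = straight refl refl
∈₂-∈₂⇒≐ (inj₂ refl) (inj₁ refl) _   = crossed refl refl
∈₂-∈₂⇒≐ (inj₂ refl) (inj₂ refl) x≢y = ⊥-elim (x≢y refl)

≢⇒≐ : x ≢ y → Σ (T2V n) λ p → p ≐⟨ x , y ⟩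
≢⇒≐ {x = x} {y = y} x≢y with <ᶠ-cmp x y
... | tri< x<y _ _ = ((x , y) , x<y) , straight refl refl
... | tri≈ _ x≡y _ = ⊥-elim (x≢y x≡y)
... | tri> _ _ y<x = ((y , x) , y<x) , crossed refl refl

_∈₂?_ : (z : Fin n) (p : T2V n) → Dec (z ∈₂ p)
z ∈₂? p = (z ≟ᶠ fst p) ⊎-dec (z ≟ᶠ snd p)

··-intro : (A B : VSet (Fin n)) → p ≐⟨ x , y ⟩ → A x → B y → (A ·· B) p
··-intro A B (straight refl refl) a b = inj₁ (a , b)
··-intro A B (crossed refl refl) a b  = inj₂ (a , b)

··-elim : (A B : VSet (Fin n)) → (A ·· B) p → p ≐⟨ x , y ⟩ → (A x × B y) ⊎ (A y × B x)
··-elim A B ab (straight refl refl) = ab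
··-elim A B ab (crossed refl refl)  = swap ab

SymDiff : T2V n → T2V n → Fin n → Set
SymDiff p q z = (z ∈₂ p × ¬ z ∈₂ q) ⊎ (z ∈₂ q × ¬ z ∈₂ p)

symDiff-not-one-sided : x ≢ y → x ∈₂ p → y ∈₂ p → ¬ x ∈₂ q → ¬ y ∈₂ q →
  ¬ (∀ z → SymDiff p q z → z ≡ x ⊎ z ≡ y)
symDiff-not-one-sided {x = x} {y = y} {p = p} {q = q} x≢y x∈p y∈p x∉q y∉q ⊆xy =
  [ (λ e → x∉q (inj₁ (≡-sym e))) , (λ e → y∉q (inj₁ (≡-sym e))) ]′ fst-q∈xy
  where
  fst-q∈xy : fst q ≡ x ⊎ fst q ≡ y
  fst-q∈xy with fst q ∈₂? p
  ... | yes fst-q∈p = ∈₂-≐ (∈₂-∈₂⇒≐ {p = p} x∈p y∈p x≢y) fst-q∈p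
  ... | no fst-q∉p  = ⊆xy (fst q) (inj₂ (inj₁ refl , fst-q∉p))

module _ {n : ℕ} (G : Graph n) where

  adj⇒≢ : Adj G x y → x ≢ y
  adj⇒≢ adj refl = irrefl G adj

  Misses : Fin n → VSet (Fin n) → Set
  Misses y A = ∀ w → A w → ¬ Adj G y w

  independent-∪-singleton : Independent G A → Misses y A → Independent G (λ z → A z ⊎ z ≡ y)
  independent-∪-singleton A-ind _ u v (inj₁ u∈A) (inj₁ v∈A) = A-ind u v u∈A v∈A
  independent-∪-singleton _ misses u v (inj₁ u∈A) (inj₂ refl) = misses u u∈A ∘ sym G
  independent-∪-singleton _ misses u v (inj₂ refl) (inj₁ v∈A) = misses v v∈A
  independent-∪-singleton _ _ _ _ (inj₂ refl) (inj₂ refl)     = irrefl G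

  SharedVertex : T2V n → T2V n → Set
  SharedVertex p q = ∃[ x ] ∃[ y ] ∃[ z ] Adj G x y × p ≐⟨ x , z ⟩ × q ≐⟨ y , z ⟩

  split-symDiff⇒SharedVertex : Adj G x y → x ∈₂ p → ¬ x ∈₂ q → y ∈₂ q → ¬ y ∈₂ p →
    (∀ z → SymDiff p q z → z ≡ x ⊎ z ≡ y) → SharedVertex p q
  split-symDiff⇒SharedVertex {p = p} {q = q} adj x∈p _ y∈q y∉p ⊆xy with ∈₂⇒≐ {p = p} x∈p
  ... | z , p≐xz with z ∈₂? q
  ...   | yes z∈q = _ , _ , z , adj , p≐xz , ∈₂-∈₂⇒≐ y∈q z∈q λ { refl → y∉p (≐⇒∈₂ʳ p≐xz) }
  ...   | no z∉q  = ⊥-elim ([ ≐⇒≢ p≐xz ∘ ≡-sym , (λ { refl → y∉p (≐⇒∈₂ʳ p≐xz) }) ]′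
                              (⊆xy z (inj₁ (≐⇒∈₂ʳ p≐xz , z∉q))))

  T2Adj⇒SharedVertex : T2Adj G p q → SharedVertex p q
  T2Adj⇒SharedVertex {p = p} {q = q} (x , y , adj , ⊆xy , xy⊆) with xy⊆ x (inj₁ refl) | xy⊆ y (inj₂ refl)
  ... | inj₁ (x∈p , x∉q) | inj₁ (y∈p , y∉q) =
    ⊥-elim (symDiff-not-one-sided {p = p} {q = q} (adj⇒≢ adj) x∈p y∈p x∉q y∉q ⊆xy)
  ... | inj₂ (x∈q , x∉p) | inj₂ (y∈q , y∉p) =
    ⊥-elim (symDiff-not-one-sided {p = q} {q = p} (adj⇒≢ adj) x∈q y∈q x∉p y∉p (λ z → ⊆xy z ∘ swap))
  ... | inj₁ (x∈p , x∉q) | inj₂ (y∈q , y∉p) =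
    split-symDiff⇒SharedVertex adj x∈p x∉q y∈q y∉p ⊆xy
  ... | inj₂ (x∈q , x∉p) | inj₁ (y∈p , y∉q) =
    split-symDiff⇒SharedVertex (sym G adj) y∈p y∉q x∈q x∉p (λ z → swap ∘ ⊆xy z)

  SharedVertex⇒T2Adj : Adj G y w → p ≐⟨ x , y ⟩ → q ≐⟨ x , w ⟩ → x ≢ y → x ≢ w → T2Adj G p q
  SharedVertex⇒T2Adj {y = y} {w = w} {p = p} {q = q} adj p≐ q≐ x≢y x≢w = y , w , adj , ⊆yw , yw⊆
    where
    ⊆yw : ∀ z → SymDiff p q z → z ≡ y ⊎ z ≡ w
    ⊆yw z (inj₁ (z∈p , z∉q)) = [ (λ { refl → ⊥-elim (z∉q (≐⇒∈₂ˡ q≐)) }) , inj₁ ]′ (∈₂-≐ p≐ z∈p)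
    ⊆yw z (inj₂ (z∈q , z∉p)) = [ (λ { refl → ⊥-elim (z∉p (≐⇒∈₂ˡ p≐)) }) , inj₂ ]′ (∈₂-≐ q≐ z∈q)
    yw⊆ : ∀ z → z ≡ y ⊎ z ≡ w → SymDiff p q z
    yw⊆ z (inj₁ refl) = inj₁ (≐⇒∈₂ʳ p≐ , [ x≢y ∘ ≡-sym , adj⇒≢ adj ]′ ∘ ∈₂-≐ q≐)
    yw⊆ z (inj₂ refl) = inj₂ (≐⇒∈₂ʳ q≐ , [ x≢w ∘ ≡-sym , adj⇒≢ adj ∘ ≡-sym ]′ ∘ ∈₂-≐ p≐)

even-or-odd : ∀ i → ∃[ m ] (i ≡ 2 * m ⊎ i ≡ suc (2 * m))
even-or-odd 0 = 0 , inj₁ refl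
even-or-odd (suc i) with even-or-odd i
... | m , inj₁ i≡2m  = m , inj₂ (cong suc i≡2m)
... | m , inj₂ i≡2m+1 = suc m , inj₁ (trans (cong suc i≡2m+1) (≡-sym (*-suc 2 m)))

module _ {n k : ℕ} (G : Graph n) (c : Fin n → Fin k)
  (parts-independent : ∀ i → Independent G (Part c i))
  (φ-later-empty : ∀ i j → i <ℕ j → ∀ x → ¬ φ G (Part c j) (Part c i) x) where

  Φ : ℕ → VSet (Fin n)
  Φ m = φ G (Part c (2 * m)) (Part c (suc (2 * m)))

  Φ-intro : ∀ m → Part c (2 * m) x → Misses G x (Part c (suc (2 * m))) → Φ m x
  Φ-intro m x∈ misses = x∈ , independent-∪-singleton G (parts-independent (suc (2 * m))) misses

  data InH (x z : Fin n) : Set where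
    even-odd  : ∀ m → suc (2 * m) <ℕ k → Part c (2 * m) x → Part c (suc (2 * m)) z → InH x z
    odd-even  : ∀ m → suc (2 * m) <ℕ k → Part c (suc (2 * m)) x → Part c (2 * m) z → InH x z
    φ-φ       : ∀ m → suc (2 * m) <ℕ k → Φ m x → Φ m z → InH x z
    last-last : ∀ m → k ≡ suc (2 * m) → Part c (2 * m) x → Part c (2 * m) z → InH x z

  InH⇒Hset : InH x z → p ≐⟨ x , z ⟩ → Hset G c p
  InH⇒Hset (even-odd m m< x∈ z∈) p≐ =
    inj₁ (m , m< , inj₁ (··-intro (Part c (2 * m)) (Part c (suc (2 * m))) p≐ x∈ z∈))
  InH⇒Hset (odd-even m m< x∈ z∈) p≐ =
    inj₁ (m , m< , inj₁ (··-intro (Part c (2 * m)) (Part c (suc (2 * m))) (≐-sym p≐) z∈ x∈))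
  InH⇒Hset (φ-φ m m< x∈ z∈) p≐ = inj₁ (m , m< , inj₂ (··-intro (Φ m) (Φ m) p≐ x∈ z∈))
  InH⇒Hset (last-last m k≡ x∈ z∈) p≐ = inj₂ (m , k≡ , ··-intro (Part c (2 * m)) (Part c (2 * m)) p≐ x∈ z∈)

  Hset⇒InH : Hset G c p → p ≐⟨ x , z ⟩ → InH x z
  Hset⇒InH (inj₁ (m , m< , inj₁ pair)) p≐ with ··-elim (Part c (2 * m)) (Part c (suc (2 * m))) pair p≐
  ... | inj₁ (x∈ , z∈) = even-odd m m< x∈ z∈
  ... | inj₂ (z∈ , x∈) = odd-even m m< x∈ z∈
  Hset⇒InH (inj₁ (m , m< , inj₂ pair)) p≐ with ··-elim (Φ m) (Φ m) pair p≐
  ... | inj₁ (x∈ , z∈) = φ-φ m m< x∈ z∈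
  ... | inj₂ (z∈ , x∈) = φ-φ m m< x∈ z∈
  Hset⇒InH (inj₂ (m , k≡ , pair)) p≐ with ··-elim (Part c (2 * m)) (Part c (2 * m)) pair p≐
  ... | inj₁ (x∈ , z∈) = last-last m k≡ x∈ z∈
  ... | inj₂ (z∈ , x∈) = last-last m k≡ x∈ z∈

  part-unique : ∀ {i j} → Part c i z → Part c j z → i ≡ j
  part-unique z∈ᵢ z∈ⱼ = trans (≡-sym z∈ᵢ) z∈ⱼ

  nonadjacent-in-part : ∀ {i j} → Part c i x → Part c j y → i ≡ j → ¬ Adj G x y
  nonadjacent-in-part {i = i} x∈ y∈ refl = parts-independent i _ _ x∈ y∈

  even-odd-distinct : ∀ m → Part c (2 * m) x → Part c (suc (2 * m)) y → x ≢ y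
  even-odd-distinct m x∈ y∈ refl = even≢odd m m (part-unique x∈ y∈)

  last-part-unpaired : ∀ a b → suc (2 * a) <ℕ k → k ≡ suc (2 * b) → 2 * a ≢ 2 * b
  last-part-unpaired a b a< refl 2a≡2b = <-irrefl (cong suc 2a≡2b) a<

  common-partner-nonadjacent : InH x z → InH y z → ¬ Adj G x y
  common-partner-nonadjacent (even-odd _ _ x∈ z∈₁) (even-odd _ _ y∈ z∈₂) =
    nonadjacent-in-part x∈ y∈ (suc-injective (part-unique z∈₁ z∈₂))
  common-partner-nonadjacent (even-odd m₁ _ _ z∈₁) (odd-even m₂ _ _ z∈₂) _ = even≢odd m₂ m₁ (part-unique z∈₂ z∈₁)
  common-partner-nonadjacent (even-odd m₁ _ _ z∈₁) (φ-φ m₂ _ _ z∈₂) _ = even≢odd m₂ m₁ (part-unique (proj₁ z∈₂) z∈₁)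
  common-partner-nonadjacent (even-odd m₁ _ _ z∈₁) (last-last m₂ _ _ z∈₂) _ = even≢odd m₂ m₁ (part-unique z∈₂ z∈₁)
  common-partner-nonadjacent (odd-even m₁ _ _ z∈₁) (even-odd m₂ _ _ z∈₂) _ = even≢odd m₁ m₂ (part-unique z∈₁ z∈₂)
  common-partner-nonadjacent (odd-even _ _ x∈ z∈₁) (odd-even _ _ y∈ z∈₂) =
    nonadjacent-in-part x∈ y∈ (cong suc (part-unique z∈₁ z∈₂))
  common-partner-nonadjacent {x = x} {y = y} (odd-even _ _ x∈ z∈₁) (φ-φ _ _ (_ , y-misses) (z∈₂ , _)) adj =
    y-misses x y (inj₁ (trans x∈ (cong suc (part-unique z∈₁ z∈₂)))) (inj₂ refl) adj
  common-partner-nonadjacent (odd-even m₁ m₁< _ z∈₁) (last-last m₂ k≡ _ z∈₂) _ =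
    last-part-unpaired m₁ m₂ m₁< k≡ (part-unique z∈₁ z∈₂)
  common-partner-nonadjacent (φ-φ m₁ _ _ z∈₁) (even-odd m₂ _ _ z∈₂) _ = even≢odd m₁ m₂ (part-unique (proj₁ z∈₁) z∈₂)
  common-partner-nonadjacent {x = x} {y = y} (φ-φ _ _ (_ , x-misses) (z∈₁ , _)) (odd-even _ _ y∈ z∈₂) adj =
    x-misses y x (inj₁ (trans y∈ (cong suc (part-unique z∈₂ z∈₁)))) (inj₂ refl) (sym G adj)
  common-partner-nonadjacent (φ-φ _ _ (x∈ , _) (z∈₁ , _)) (φ-φ _ _ (y∈ , _) (z∈₂ , _)) =
    nonadjacent-in-part x∈ y∈ (part-unique z∈₁ z∈₂)
  common-partner-nonadjacent (φ-φ _ _ (x∈ , _) (z∈₁ , _)) (last-last _ _ y∈ z∈₂) =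
    nonadjacent-in-part x∈ y∈ (part-unique z∈₁ z∈₂)
  common-partner-nonadjacent (last-last m₁ _ _ z∈₁) (even-odd m₂ _ _ z∈₂) _ = even≢odd m₁ m₂ (part-unique z∈₁ z∈₂)
  common-partner-nonadjacent (last-last m₁ k≡ _ z∈₁) (odd-even m₂ m₂< _ z∈₂) _ =
    last-part-unpaired m₂ m₁ m₂< k≡ (part-unique z∈₂ z∈₁)
  common-partner-nonadjacent (last-last _ _ x∈ z∈₁) (φ-φ _ _ (y∈ , _) (z∈₂ , _)) =
    nonadjacent-in-part x∈ y∈ (part-unique z∈₁ z∈₂)
  common-partner-nonadjacent (last-last _ _ x∈ z∈₁) (last-last _ _ y∈ z∈₂) =
    nonadjacent-in-part x∈ y∈ (part-unique z∈₁ z∈₂)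

  H-independent : T2Independent G (Hset G c)
  H-independent p q p∈H q∈H p~q =
    let (_ , _ , _ , adj , p≐ , q≐) = T2Adj⇒SharedVertex G {p = p} {q = q} p~q
    in common-partner-nonadjacent (Hset⇒InH p∈H p≐) (Hset⇒InH q∈H q≐) adj

  ¬misses-earlier-part : ∀ {l} → l <ℕ toℕ (c y) → ¬ Misses G y (Part c l)
  ¬misses-earlier-part {y = y} {l = l} l< misses =
    φ-later-empty l (toℕ (c y)) l< y (refl , independent-∪-singleton G (parts-independent l) misses)

  module _ (S : VSet (T2V n)) (S-independent : T2Independent G S) (H⊆S : Hset G c ⊆ S) where

    H-partner-nonadjacent : S p → p ≐⟨ x , y ⟩ → InH x w → w ≢ x → ¬ Adj G y w
    H-partner-nonadjacent p∈S p≐ xw∈H w≢x adj =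
      let (q , q≐) = ≢⇒≐ (w≢x ∘ ≡-sym)
      in S-independent _ q p∈S (H⊆S q (InH⇒Hset xw∈H q≐))
           (SharedVertex⇒T2Adj G adj p≐ q≐ (≐⇒≢ p≐) (w≢x ∘ ≡-sym))

    misses-next-part : S p → p ≐⟨ x , y ⟩ → ∀ m → suc (2 * m) <ℕ k → Part c (2 * m) x →
      Misses G y (Part c (suc (2 * m)))
    misses-next-part p∈S p≐ m m< x∈ w w∈ =
      H-partner-nonadjacent p∈S p≐ (even-odd m m< x∈ w∈) (even-odd-distinct m x∈ w∈ ∘ ≡-sym)

    S⊆H-within-even-part : S p → p ≐⟨ x , y ⟩ → ∀ m → Part c (2 * m) x → Part c (2 * m) y → Hset G c p
    S⊆H-within-even-part {x = x} {y = y} p∈S p≐ m x∈ y∈ with suc (2 * m) <? k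
    ... | yes m<k = InH⇒Hset (φ-φ m m<k x∈Φ y∈Φ) p≐
      where
      x∈Φ : Φ m x
      x∈Φ = Φ-intro m x∈ (misses-next-part p∈S (≐-sym p≐) m m<k y∈)
      y∈Φ : Φ m y
      y∈Φ = Φ-intro m y∈ (misses-next-part p∈S p≐ m m<k x∈)
    ... | no m≮k = InH⇒Hset (last-last m (≤-antisym (≮⇒≥ m≮k) (subst (_<ℕ k) x∈ (toℕ<n (c x)))) x∈ y∈) p≐

    S⊆H-ordered : S p → p ≐⟨ x , y ⟩ → toℕ (c x) ≤ toℕ (c y) → Hset G c p
    S⊆H-ordered {x = x} {y = y} p∈S p≐ cx≤cy with even-or-odd (toℕ (c x))
    ... | m , inj₂ x∈ =
      ⊥-elim (¬misses-earlier-part (subst (_≤ toℕ (c y)) x∈ cx≤cy) λ w w∈ →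
        H-partner-nonadjacent p∈S p≐ (odd-even m (subst (_<ℕ k) x∈ (toℕ<n (c x))) x∈ w∈)
          (even-odd-distinct m w∈ x∈))
    ... | m , inj₁ x∈ with <-cmp (toℕ (c y)) (suc (2 * m))
    ...   | tri≈ _ y∈ _ = InH⇒Hset (even-odd m (subst (_<ℕ k) y∈ (toℕ<n (c y))) x∈ y∈) p≐
    ...   | tri> _ _ m<cy =
      ⊥-elim (¬misses-earlier-part m<cy (misses-next-part p∈S p≐ m (<-trans m<cy (toℕ<n (c y))) x∈))
    ...   | tri< cy<m _ _ =
      S⊆H-within-even-part p∈S p≐ m x∈ (≤-antisym (≤-pred cy<m) (subst (_≤ toℕ (c y)) x∈ cx≤cy))

    S⊆H : S ⊆ Hset G c
    S⊆H p p∈S with ≤-total (toℕ (c (fst p))) (toℕ (c (snd p)))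
    ... | inj₁ fst≤snd = S⊆H-ordered p∈S ≐-canonical fst≤snd
    ... | inj₂ snd≤fst = S⊆H-ordered p∈S (≐-sym ≐-canonical) snd≤fst

theorem3p9 : (n k : ℕ) (G : Graph n) (c : Fin n → Fin k) →
    Surjective c →
    (∀ (i : ℕ) → Independent G (Part c i)) →
    (∀ (i j : ℕ) → i <ℕ j → ∀ x → ¬ φ G (Part c j) (Part c i) x) →
    MaximalT2Independent G (Hset G c)
theorem3p9 n k G c _ parts-independent φ-later-empty =
  H-independent G c parts-independent φ-later-empty ,
  S⊆H G c parts-independent φ-later-empty
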